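{- Given contexts $\Theta$, $\Gamma$ and $\Delta$ (with $\Theta$ disjoint from $\Gamma$ and $\Delta$), if $\Gamma\le^s\Delta$ then $\Theta,\Gamma\le^s\Theta,\Delta$.
   Context: Simply typed $\lambda$-calculus over base type $0$; a context is a finite list of distinct typed variables, $\{\Gamma\}$ its variable set; terms identified up to $\beta\eta$-conversion; $\Lambda^\Xi(A)$ = terms of type $A$ with free variables in $\{\Xi\}$. A substitution $\varrho$ from $\Gamma$ to $\Delta$ assigns $\varrho_c\in\Lambda^\Delta(C)$ to each $c^C\in\{\Gamma\}$; for a context $\Xi$ of fresh variables, $\varrho^\Xi$ is the substitution from $\Xi,\Gamma$ to $\Xi,\Delta$ equal to $\varrho$ on $\{\Gamma\}$ and the identity on $\{\Xi\}$, and $\hat\varrho^\Xi\colon\Lambda^{\Xi,\Gamma}(0)\to\Lambda^{\Xi,\Delta}(0)$, $M\mapsto M[\Gamma:=\varrho]$. $\Gamma\le^s\Delta$ means there is a substitution $\varrho$ from $\Gamma$ to $\Delta$ with $\hat\varrho^\Xi$ injective for every fresh context $\Xi$. -}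

module Defs where

open import Data.List using (List; []; _∷_; _++_)
open import Data.Product using (Σ)

-- Simple types over the base type 0 (written ι)
data Ty : Set where
  ι   : Ty
  _⇒_ : Ty → Ty → Ty

infixr 7 _⇒_

-- A context is a list of typed variables (de Bruijn: variables are positions,
-- hence automatically distinct; concatenation of contexts is disjoint union).
Ctx : Set
Ctx = List Ty

infix 4 _∋_
data _∋_ : Ctx → Ty → Set where
  here  : ∀ {Γ A} → (A ∷ Γ) ∋ A
  there : ∀ {Γ A B} → Γ ∋ A → (B ∷ Γ) ∋ A

data Tm (Γ : Ctx) : Ty → Set where
  var : ∀ {A} → Γ ∋ A → Tm Γ A
  lam : ∀ {A B} → Tm (A ∷ Γ) B → Tm Γ (A ⇒ B)
  app : ∀ {A B} → Tm Γ (A ⇒ B) → Tm Γ A → Tm Γ B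

Ren : Ctx → Ctx → Set
Ren Γ Δ = ∀ {A} → Γ ∋ A → Δ ∋ A

ext : ∀ {Γ Δ B} → Ren Γ Δ → Ren (B ∷ Γ) (B ∷ Δ)
ext r here      = here
ext r (there x) = there (r x)

ren : ∀ {Γ Δ A} → Ren Γ Δ → Tm Γ A → Tm Δ A
ren r (var x)   = var (r x)
ren r (lam M)   = lam (ren (ext r) M)
ren r (app M N) = app (ren r M) (ren r N)

wk : ∀ {Γ A B} → Tm Γ A → Tm (B ∷ Γ) A
wk = ren there

Sub : Ctx → Ctx → Set
Sub Γ Δ = ∀ {C} → Γ ∋ C → Tm Δ C

exts : ∀ {Γ Δ B} → Sub Γ Δ → Sub (B ∷ Γ) (B ∷ Δ)
exts ρ here      = var here
exts ρ (there x) = wk (ρ x)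

sub : ∀ {Γ Δ A} → Sub Γ Δ → Tm Γ A → Tm Δ A
sub ρ (var x)   = ρ x
sub ρ (lam M)   = lam (sub (exts ρ) M)
sub ρ (app M N) = app (sub ρ M) (sub ρ N)

sub1 : ∀ {Γ A} → Tm Γ A → Sub (A ∷ Γ) Γ
sub1 N here      = N
sub1 N (there x) = var x

_[_] : ∀ {Γ A B} → Tm (A ∷ Γ) B → Tm Γ A → Tm Γ B
M [ N ] = sub (sub1 N) M

-- βη-conversion (terms are identified up to this equivalence)
infix 4 _≈_
data _≈_ : ∀ {Γ A} → Tm Γ A → Tm Γ A → Set where
  ≈-refl  : ∀ {Γ A} {M : Tm Γ A} → M ≈ M
  ≈-sym   : ∀ {Γ A} {M N : Tm Γ A} → M ≈ N → N ≈ M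
  ≈-trans : ∀ {Γ A} {M N P : Tm Γ A} → M ≈ N → N ≈ P → M ≈ P
  ≈-lam   : ∀ {Γ A B} {M N : Tm (A ∷ Γ) B} → M ≈ N → lam M ≈ lam N
  ≈-app   : ∀ {Γ A B} {M M' : Tm Γ (A ⇒ B)} {N N' : Tm Γ A} →
            M ≈ M' → N ≈ N' → app M N ≈ app M' N'
  ≈-β     : ∀ {Γ A B} (M : Tm (A ∷ Γ) B) (N : Tm Γ A) → app (lam M) N ≈ M [ N ]
  ≈-η     : ∀ {Γ A B} (M : Tm Γ (A ⇒ B)) → lam (app (wk M) (var here)) ≈ M

lift : ∀ {Γ Δ} (Ξ : Ctx) → Sub Γ Δ → Sub (Ξ ++ Γ) (Ξ ++ Δ)
lift []      ρ = ρ
lift (B ∷ Ξ) ρ = exts (lift Ξ ρ)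

hat : ∀ {Γ Δ} → Sub Γ Δ → (Ξ : Ctx) → Tm (Ξ ++ Γ) ι → Tm (Ξ ++ Δ) ι
hat ρ Ξ M = sub (lift Ξ ρ) M

Injective≈ : ∀ {Γ Δ A} → (Tm Γ A → Tm Δ A) → Set
Injective≈ {Γ} {Δ} {A} f = ∀ (M N : Tm Γ A) → f M ≈ f N → M ≈ N

_≤ˢ_ : Ctx → Ctx → Set
Γ ≤ˢ Δ = Σ (Sub Γ Δ) (λ ρ → ∀ (Ξ : Ctx) → Injective≈ (hat ρ Ξ))

module Submission where

-- Take ρ^Θ as the witness.  Up to the reassociation renaming Ξ,(Θ,Γ) → (Ξ,Θ),Γ, the map
-- (ρ^Θ)^Ξ is ρ^{Ξ,Θ}.  Renamings preserve βη-conversion and this one has a left inverse,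
-- so injectivity of ρ̂^{Ξ,Θ} transfers to the hat of (ρ^Θ) at Ξ.

open import Defs
open import Data.List using ([]; _∷_; _++_)
open import Data.Product using (_,_)
open import Relation.Binary.PropositionalEquality
  using (_≡_; refl; cong; cong₂; sym; trans; subst₂; module ≡-Reasoning)

_≗ʳ_ : ∀ {Γ Δ} → Ren Γ Δ → Ren Γ Δ → Set
r ≗ʳ r' = ∀ {A} (x : _ ∋ A) → r x ≡ r' x

_≗ˢ_ : ∀ {Γ Δ} → Sub Γ Δ → Sub Γ Δ → Set
σ ≗ˢ σ' = ∀ {A} (x : _ ∋ A) → σ x ≡ σ' x

_∘ʳ_ : ∀ {Γ Δ E} → Ren Δ E → Ren Γ Δ → Ren Γ E
(s ∘ʳ r) x = s (r x)

ext-cong : ∀ {Γ Δ B} {r r' : Ren Γ Δ} → r ≗ʳ r' → ext {B = B} r ≗ʳ ext r'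
ext-cong h here      = refl
ext-cong h (there x) = cong there (h x)

ren-cong : ∀ {Γ Δ A} {r r' : Ren Γ Δ} → r ≗ʳ r' → (M : Tm Γ A) → ren r M ≡ ren r' M
ren-cong h (var x)   = cong var (h x)
ren-cong h (lam M)   = cong lam (ren-cong (ext-cong h) M)
ren-cong h (app M N) = cong₂ app (ren-cong h M) (ren-cong h N)

exts-cong : ∀ {Γ Δ B} {σ σ' : Sub Γ Δ} → σ ≗ˢ σ' → exts {B = B} σ ≗ˢ exts σ'
exts-cong h here      = refl
exts-cong h (there x) = cong wk (h x)

sub-cong : ∀ {Γ Δ A} {σ σ' : Sub Γ Δ} → σ ≗ˢ σ' → (M : Tm Γ A) → sub σ M ≡ sub σ' M
sub-cong h (var x)   = h x
sub-cong h (lam M)   = cong lam (sub-cong (exts-cong h) M)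
sub-cong h (app M N) = cong₂ app (sub-cong h M) (sub-cong h N)

ren-id : ∀ {Γ A} {r : Ren Γ Γ} → (∀ {B} (x : Γ ∋ B) → r x ≡ x) → (M : Tm Γ A) → ren r M ≡ M
ren-id h (var x)   = cong var (h x)
ren-id h (lam M)   = cong lam (ren-id (λ { here → refl ; (there x) → cong there (h x) }) M)
ren-id h (app M N) = cong₂ app (ren-id h M) (ren-id h N)

ext-∘ : ∀ {Γ Δ E B} (s : Ren Δ E) (r : Ren Γ Δ) → (ext {B = B} s ∘ʳ ext r) ≗ʳ ext (s ∘ʳ r)
ext-∘ s r here      = refl
ext-∘ s r (there x) = refl

ren-∘ : ∀ {Γ Δ E A} (s : Ren Δ E) (r : Ren Γ Δ) (M : Tm Γ A) →
        ren s (ren r M) ≡ ren (s ∘ʳ r) M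
ren-∘ s r (var x)   = refl
ren-∘ s r (lam M)   = cong lam (trans (ren-∘ (ext s) (ext r) M) (ren-cong (ext-∘ s r) M))
ren-∘ s r (app M N) = cong₂ app (ren-∘ s r M) (ren-∘ s r N)

ren-wk : ∀ {Γ Δ A B} (r : Ren Γ Δ) (M : Tm Γ A) → ren (ext {B = B} r) (wk M) ≡ wk (ren r M)
ren-wk r M = trans (ren-∘ (ext r) there M) (sym (ren-∘ there r M))

sub-ren : ∀ {Γ Δ E A} (σ : Sub Δ E) (r : Ren Γ Δ) (M : Tm Γ A) →
          sub σ (ren r M) ≡ sub (λ x → σ (r x)) M
sub-ren σ r (var x)   = refl
sub-ren σ r (lam M)   = cong lam (trans (sub-ren (exts σ) (ext r) M)
  (sub-cong (λ { here → refl ; (there x) → refl }) M))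
sub-ren σ r (app M N) = cong₂ app (sub-ren σ r M) (sub-ren σ r N)

ren-sub : ∀ {Γ Δ E A} (r : Ren Δ E) (σ : Sub Γ Δ) (M : Tm Γ A) →
          ren r (sub σ M) ≡ sub (λ x → ren r (σ x)) M
ren-sub r σ (var x)   = refl
ren-sub r σ (lam M)   = cong lam (trans (ren-sub (ext r) (exts σ) M)
  (sub-cong (λ { here → refl ; (there x) → ren-wk r (σ x) }) M))
ren-sub r σ (app M N) = cong₂ app (ren-sub r σ M) (ren-sub r σ N)

ren-[] : ∀ {Γ Δ A B} (r : Ren Γ Δ) (M : Tm (A ∷ Γ) B) (N : Tm Γ A) →
         ren r (M [ N ]) ≡ ren (ext r) M [ ren r N ]
ren-[] r M N = begin
  ren r (M [ N ])                      ≡⟨ ren-sub r (sub1 N) M ⟩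
  sub (λ x → ren r (sub1 N x)) M       ≡⟨ sub-cong (λ { here → refl ; (there x) → refl }) M ⟩
  sub (λ x → sub1 (ren r N) (ext r x)) M ≡⟨ sym (sub-ren (sub1 (ren r N)) (ext r) M) ⟩
  ren (ext r) M [ ren r N ]            ∎
  where open ≡-Reasoning

ren-≈ : ∀ {Γ Δ A} (r : Ren Γ Δ) {M N : Tm Γ A} → M ≈ N → ren r M ≈ ren r N
ren-≈ r ≈-refl        = ≈-refl
ren-≈ r (≈-sym p)     = ≈-sym (ren-≈ r p)
ren-≈ r (≈-trans p q) = ≈-trans (ren-≈ r p) (ren-≈ r q)
ren-≈ r (≈-lam p)     = ≈-lam (ren-≈ (ext r) p)
ren-≈ r (≈-app p q)   = ≈-app (ren-≈ r p) (ren-≈ r q)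
ren-≈ r (≈-β M N)     = subst₂ _≈_ refl (sym (ren-[] r M N)) (≈-β _ _)
ren-≈ r (≈-η M)       = subst₂ _≈_ (cong (λ L → lam (app L (var here))) (sym (ren-wk r M))) refl (≈-η _)

Injective≈-conjugate : ∀ {Γ Δ Γ' Δ' A} {f : Tm Γ A → Tm Δ A} {g : Tm Γ' A → Tm Δ' A}
  (r : Ren Γ Γ') (s : Ren Γ' Γ) (r' : Ren Δ Δ') →
  (∀ {B} (x : Γ ∋ B) → s (r x) ≡ x) →
  (∀ M → g (ren r M) ≡ ren r' (f M)) →
  Injective≈ g → Injective≈ f
Injective≈-conjugate r s r' sr≡id square inj-g M N fM≈fN =
  subst₂ _≈_ (retract M) (retract N)
    (ren-≈ s (inj-g (ren r M) (ren r N)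
      (subst₂ _≈_ (sym (square M)) (sym (square N)) (ren-≈ r' fM≈fN))))
  where
  retract : ∀ L → ren s (ren r L) ≡ L
  retract L = trans (ren-∘ s r L) (ren-id sr≡id L)

reassoc : ∀ Ξ {Θ Γ} → Ren (Ξ ++ (Θ ++ Γ)) ((Ξ ++ Θ) ++ Γ)
reassoc []      x = x
reassoc (C ∷ Ξ)   = ext (reassoc Ξ)

unreassoc : ∀ Ξ {Θ Γ} → Ren ((Ξ ++ Θ) ++ Γ) (Ξ ++ (Θ ++ Γ))
unreassoc []      x = x
unreassoc (C ∷ Ξ)   = ext (unreassoc Ξ)

unreassoc-reassoc : ∀ Ξ {Θ Γ B} (x : (Ξ ++ (Θ ++ Γ)) ∋ B) → unreassoc Ξ {Θ} (reassoc Ξ x) ≡ x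
unreassoc-reassoc []      x         = refl
unreassoc-reassoc (C ∷ Ξ) here      = refl
unreassoc-reassoc (C ∷ Ξ) (there x) = cong there (unreassoc-reassoc Ξ x)

lift-++-var : ∀ Ξ Θ {Γ Δ B} (ρ : Sub Γ Δ) (x : (Ξ ++ (Θ ++ Γ)) ∋ B) →
              lift (Ξ ++ Θ) ρ (reassoc Ξ x) ≡ ren (reassoc Ξ) (lift Ξ (lift Θ ρ) x)
lift-++-var []      Θ ρ x         = sym (ren-id (λ _ → refl) (lift Θ ρ x))
lift-++-var (C ∷ Ξ) Θ ρ here      = refl
lift-++-var (C ∷ Ξ) Θ ρ (there x) = trans (cong wk (lift-++-var Ξ Θ ρ x))
                                          (sym (ren-wk (reassoc Ξ) (lift Ξ (lift Θ ρ) x)))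

hat-lift : ∀ Ξ Θ {Γ Δ} (ρ : Sub Γ Δ) (M : Tm (Ξ ++ (Θ ++ Γ)) ι) →
           hat ρ (Ξ ++ Θ) (ren (reassoc Ξ) M) ≡ ren (reassoc Ξ) (hat (lift Θ ρ) Ξ M)
hat-lift Ξ Θ ρ M = begin
  sub (lift (Ξ ++ Θ) ρ) (ren (reassoc Ξ) M)             ≡⟨ sub-ren (lift (Ξ ++ Θ) ρ) (reassoc Ξ) M ⟩
  sub (λ x → lift (Ξ ++ Θ) ρ (reassoc Ξ x)) M          ≡⟨ sub-cong (lift-++-var Ξ Θ ρ) M ⟩
  sub (λ x → ren (reassoc Ξ) (lift Ξ (lift Θ ρ) x)) M  ≡⟨ sym (ren-sub (reassoc Ξ) (lift Ξ (lift Θ ρ)) M) ⟩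
  ren (reassoc Ξ) (sub (lift Ξ (lift Θ ρ)) M)           ∎
  where open ≡-Reasoning

lemmaL : ∀ (Θ Γ Δ : Ctx) → Γ ≤ˢ Δ → (Θ ++ Γ) ≤ˢ (Θ ++ Δ)
lemmaL Θ Γ Δ (ρ , inj) = lift Θ ρ , λ Ξ →
  Injective≈-conjugate (reassoc Ξ) (unreassoc Ξ) (reassoc Ξ)
    (unreassoc-reassoc Ξ) (hat-lift Ξ Θ ρ) (inj (Ξ ++ Θ))
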